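{- Let $D=(d_1,\dots,d_t)$ be a reduced degree sequence and let $\mathcal{M}(D)$ be the tree defined below. Then for every choice of a root of $\mathcal{M}(D)$ (a vertex or an edge), every level $i$, and every two vertices $p,q$ at level $i$ with $\deg(p)>\deg(q)$, every child $a$ of $p$ and every child $b$ of $q$ satisfy $\deg(a)\le\deg(b)$.
   Context: Rooting a tree at a vertex $r$: level $i$ consists of vertices at distance $i-1$ from $r$; children of $x$ are its neighbours at the next level. Rooting at an edge $r_1r_2$: level $i$ consists of vertices at distance $i-1$ from $\{r_1,r_2\}$; children of $x$ are its neighbours at the next level. A reduced degree sequence is a nonincreasing sequence $(d_1,\dots,d_t)$ of integers $d_i\ge 2$ that is the list of degrees of the non-leaf vertices of some tree; such a tree has exactly $2-2t+\sum_i d_i$ leaves. The tree $\mathcal{M}(d_1,\dots,d_t)$ (alternating greedy tree), together with labels $v_1,v_2,\dots$ on some of its non-leaf vertices, is defined recursively in $t$. (i) If $t\le d_t+1$: take a star with centre $c$ and $d_t$ leaves; for each $i=1,\dots,t-1$ identify a distinct leaf of this star with the centre of a star having $d_i-1$ leaves (so this vertex gets degree $d_i$). Label $c$ as $v_1$ and the other non-leaf vertices $v_2,\dots,v_t$ so that $\deg(v_i)\le\deg(v_j)$ whenever $i<j$. (ii) If $t\ge d_t+2$: let $\mathcal{M}'=\mathcal{M}(d_{d_t},d_{d_t+1},\dots,d_{t-1})$ with its labels $v_1,\dots,v_\ell$ ($\ell$ the largest label index in $\mathcal{M}'$), and let $s$ be the smallest index such that $v_s$ is adjacent to a leaf of $\mathcal{M}'$.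 Let $R$ be the rooted tree with root $r$ having $d_t-1$ children $x_1,\dots,x_{d_t-1}$, where $x_i$ has $d_i-1$ further neighbours, all leaves. $\mathcal{M}(D)$ is obtained by identifying $r$ with a leaf of $\mathcal{M}'$ adjacent to $v_s$ (so $r$ gets degree $d_t$); the vertices $x_1,\dots,x_{d_t-1}$ get the labels $v_{\ell+1},\dots,v_{\ell+d_t-1}$ in nondecreasing order of degree ($r$ is not labelled). Where ties allow several choices, any choice may be made. -}

module Defs where

open import Data.Nat using (ℕ; zero; suc; _+_; _∸_; _≤_; _<_; _≡ᵇ_; _≤ᵇ_)
open import Data.Bool using (_∨_)
open import Data.List using (List; []; _∷_; _++_; length; map; zip; filterᵇ; applyUpTo; upTo)
open import Data.List.Membership.Propositional using (_∈_)
open import Data.List.Relation.Unary.All using (All)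
open import Data.List.Relation.Unary.Any using (Any)
open import Data.List.Relation.Unary.Linked using (Linked)
open import Data.List.Relation.Binary.Permutation.Propositional using (_↭_)
open import Data.Product using (_×_; _,_; proj₁; proj₂; ∃; ∃-syntax)
open import Data.Sum using (_⊎_)
open import Relation.Nullary using (¬_)
open import Relation.Binary.PropositionalEquality using (_≡_; _≢_)

-- Finite graphs: vertices 0 … n-1, edges as an (unordered) edge list.

record Graph : Set where
  constructor mkGraph
  field
    size  : ℕ
    edges : List (ℕ × ℕ)
open Graph public

Adj : Graph → ℕ → ℕ → Set
Adj G u v = ((u , v) ∈ edges G) ⊎ ((v , u) ∈ edges G)

-- degree = number of incident edges (graphs here have no loops / multi-edges)
deg : Graph → ℕ → ℕ
deg G v = length (filterᵇ (λ e → (proj₁ e ≡ᵇ v) ∨ (proj₂ e ≡ᵇ v)) (edges G))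

data Walk (G : Graph) : ℕ → ℕ → ℕ → Set where
  here : ∀ {u} → Walk G u u 0
  step : ∀ {u v w k} → Adj G u v → Walk G v w k → Walk G u w (suc k)

AtDist : Graph → List ℕ → ℕ → ℕ → Set
AtDist G rs x k =
  Any (λ r → Walk G r x k) rs × All (λ r → ∀ j → j < k → ¬ Walk G r x j) rs

IsTree : Graph → Set
IsTree G =
  (1 ≤ size G) × (length (edges G) + 1 ≡ size G)
  × All (λ e → (proj₁ e < size G) × (proj₂ e < size G) × (proj₁ e ≢ proj₂ e)) (edges G)
  × (∀ u v → u < size G → v < size G → ∃[ k ] Walk G u v k)

nonLeafDegrees : Graph → List ℕ
nonLeafDegrees G = map (deg G) (filterᵇ (λ v → 2 ≤ᵇ deg G v) (upTo (size G)))

-- reduced degree sequence (nonempty, as M(D) requires t ≥ 1)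
ReducedDegSeq : List ℕ → Set
ReducedDegSeq D =
  (1 ≤ length D) × Linked (λ a b → b ≤ a) D × All (λ d → 2 ≤ d) D
  × ∃[ G ] (IsTree G × (nonLeafDegrees G ↭ D))

hang : ℕ → ℕ → ℕ → List (ℕ × ℕ)
hang v m s = applyUpTo (λ j → (v , s + j)) m

attach : List (ℕ × ℕ) → ℕ → List (ℕ × ℕ) × ℕ
attach [] nxt = [] , nxt
attach ((v , m) ∷ rest) nxt with attach rest (nxt + m)
... | es , nxt' = hang v m nxt ++ es , nxt'

NondecDeg : Graph → List ℕ → Set
NondecDeg G = Linked (λ a b → deg G a ≤ deg G b)

AdjLeaf : Graph → ℕ → Set
AdjLeaf G v = ∃[ u ] (deg G u ≡ 1 × Adj G v u)

-- case (i): D = ds ++ [dt], centre 0, its leaves 1..dt, leaf i (1 ≤ i ≤ t-1)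
-- becomes the centre of a star with d_i - 1 new leaves.
caseI : List ℕ → ℕ → Graph
caseI ds dt =
  let r = attach (zip (applyUpTo suc (length ds)) (map (_∸ 1) ds)) (suc dt)
  in mkGraph (proj₂ r) (hang 0 dt 1 ++ proj₁ r)

-- case (ii): glue R onto leaf u of G'; xs = (d_1,…,d_{dt-1});
-- x_i is the new vertex size G' + (i-1), its leaves come afterwards.
caseII : Graph → ℕ → List ℕ → Graph
caseII G' u xs =
  let n' = size G'
      k  = length xs
      r  = attach (zip (applyUpTo (n' +_) k) (map (_∸ 1) xs)) (n' + k)
  in mkGraph (proj₂ r) (edges G' ++ hang u k n' ++ proj₁ r)

-- IsM D G L : G (with label list L = v₁, v₂, …) is a possible M(D)
data IsM : List ℕ → Graph → List ℕ → Set where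
  base : ∀ ds dt X →
         length ds ≤ dt →                       -- t ≤ d_t + 1
         X ↭ applyUpTo suc (length ds) →
         NondecDeg (caseI ds dt) X →
         IsM (ds ++ dt ∷ []) (caseI ds dt) (0 ∷ X)
  rec  : ∀ xs D' dt G' L' pre vs post u X →
         length xs ≡ dt ∸ 1 →
         dt + 2 ≤ length (xs ++ D') + 1 →       -- t ≥ d_t + 2
         IsM D' G' L' →
         L' ≡ pre ++ vs ∷ post →
         All (λ v → ¬ AdjLeaf G' v) pre →        -- s is the smallest such index
         deg G' u ≡ 1 → Adj G' vs u →
         X ↭ applyUpTo (size G' +_) (length xs) →
         NondecDeg (caseII G' u xs) X →
         IsM (xs ++ D' ++ dt ∷ []) (caseII G' u xs) (L' ++ X)

data Root (G : Graph) : List ℕ → Set where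
  vroot : ∀ r → r < size G → Root G (r ∷ [])
  eroot : ∀ r₁ r₂ → Adj G r₁ r₂ → Root G (r₁ ∷ r₂ ∷ [])

{-# OPTIONS --safe #-}
-- Call (p, q, a, b) a degree inversion if p ~ a, q ~ b, deg q < deg p, deg b < deg a, some
-- p–q walk avoids a and some q–p walk avoids b.  Children of two vertices of one level form
-- one, because the walks through the root stay on levels ≤ k; so it suffices that M(D) has
-- no degree inversion.
--
-- This is proved along the construction, together with the invariants that every degree is
-- ≤ 1 or occurs in D, that the labels are internal vertices sorted by degree, and that every
-- vertex adjacent to a leaf is labelled.  A step grafts stars with the largest degrees onto a
-- leaf u of the previous tree, so an inversion of the new tree lives on old vertices.  If it
-- avoids u it is an inversion of the old tree.  Otherwise q = u is impossible since u was a
-- leaf, and a = u forces p = vₛ and b to be a leaf; then q is labelled, and the minimality of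
-- s puts q after vₛ in the label order, contradicting deg q < deg vₛ.
module Submission where

open import Defs
open import Data.Bool using (Bool; T; _∨_)
open import Data.Bool.Properties using (T-∨; T?)
open import Data.Empty using (⊥; ⊥-elim)
open import Data.List using (List; []; _∷_; _++_; _∷ʳ_; length; filterᵇ; zip; map; applyUpTo)
open import Data.List.Properties
  using (length-++; length-applyUpTo; applyUpTo-∷ʳ; map-cong-local
        ; filter-++; filter-accept; filter-reject; filter-all; filter-none; filter-some)
open import Data.List.Membership.Propositional using (_∈_; lose; find)
open import Data.List.Membership.Propositional.Properties
  using (∈-++⁻; ∈-++⁺ˡ; ∈-++⁺ʳ; ∈-applyUpTo⁺; ∈-applyUpTo⁻)
open import Data.List.Relation.Unary.Any using (here; there)
open import Data.List.Relation.Unary.All as All using (All; []; _∷_)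
import Data.List.Relation.Unary.All.Properties as AllP
open import Data.List.Relation.Unary.AllPairs using (AllPairs; []; _∷_)
import Data.List.Relation.Unary.AllPairs.Properties as AllPairsP
open import Data.List.Relation.Unary.Linked.Properties using (Linked⇒AllPairs)
open import Data.List.Relation.Binary.Permutation.Propositional using (_↭_; ↭-sym)
open import Data.List.Relation.Binary.Permutation.Propositional.Properties using (∈-resp-↭)
open import Data.Nat using (ℕ; zero; suc; _+_; _∸_; _≤_; _<_; _≡ᵇ_; z≤n; s≤s; _≟_; _<?_; _≤?_)
open import Data.Nat.Properties
open import Data.Product as Product using (_×_; _,_; proj₁; proj₂; ∃-syntax)
open import Data.Sum as Sum using (_⊎_; inj₁; inj₂; [_,_]′)
open import Function using (_∘_; flip; Equivalence)
open import Relation.Nullary using (¬_; Dec; yes; no)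
open import Relation.Binary.PropositionalEquality

incident : ℕ → ℕ × ℕ → Bool
incident v e = (proj₁ e ≡ᵇ v) ∨ (proj₂ e ≡ᵇ v)

degIn : ℕ → List (ℕ × ℕ) → ℕ
degIn v E = length (filterᵇ (incident v) E)

incident-fst : ∀ v y → T (incident v (v , y))
incident-fst v y = Equivalence.from T-∨ (inj₁ (≡⇒≡ᵇ v v refl))

incident-snd : ∀ v x → T (incident v (x , v))
incident-snd v x = Equivalence.from T-∨ (inj₂ (≡⇒≡ᵇ v v refl))

incident⁻ : ∀ {v x y} → T (incident v (x , y)) → x ≡ v ⊎ y ≡ v
incident⁻ {v} {x} {y} = Sum.map (≡ᵇ⇒≡ x v) (≡ᵇ⇒≡ y v) ∘ Equivalence.to T-∨

degIn-++ : ∀ v E F → degIn v (E ++ F) ≡ degIn v E + degIn v F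
degIn-++ v E F = trans (cong length (filter-++ (T? ∘ incident v) E F)) (length-++ (filterᵇ (incident v) E))

degIn-∷-incident : ∀ {v} e E → T (incident v e) → degIn v (e ∷ E) ≡ suc (degIn v E)
degIn-∷-incident {v} e E t = cong length (filter-accept (T? ∘ incident v) {x = e} {xs = E} t)

degIn-∷-nonincident : ∀ {v} e E → ¬ T (incident v e) → degIn v (e ∷ E) ≡ degIn v E
degIn-∷-nonincident {v} e E t = cong length (filter-reject (T? ∘ incident v) {x = e} {xs = E} t)

nonincident : ∀ {v x y} → x ≢ v → y ≢ v → ¬ T (incident v (x , y))
nonincident x≢v y≢v = [ x≢v , y≢v ]′ ∘ incident⁻

degIn-∷-≤ : ∀ {v} e E → degIn v E ≤ degIn v (e ∷ E)
degIn-∷-≤ {v} e E with T? (incident v e)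
... | yes t = ≤-trans (n≤1+n _) (≤-reflexive (sym (degIn-∷-incident e E t)))
... | no t = ≤-reflexive (sym (degIn-∷-nonincident e E t))

degIn-isolated : ∀ {v} E → (∀ {x y} → (x , y) ∈ E → x ≢ v × y ≢ v) → degIn v E ≡ 0
degIn-isolated {v} E h =
  cong length (filter-none (T? ∘ incident v) (All.tabulate λ m → nonincident (proj₁ (h m)) (proj₂ (h m))))

1≤degIn : ∀ {v e} E → e ∈ E → T (incident v e) → 1 ≤ degIn v E
1≤degIn {v} E m t = filter-some (T? ∘ incident v) (lose m t)

2≤degIn : ∀ {v e₁ e₂} E → e₁ ∈ E → e₂ ∈ E → e₁ ≢ e₂ →
  T (incident v e₁) → T (incident v e₂) → 2 ≤ degIn v E
2≤degIn (e ∷ E) (here refl) (here refl) e₁≢e₂ _ _ = ⊥-elim (e₁≢e₂ refl)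
2≤degIn (e ∷ E) (here refl) (there m₂) _ t₁ t₂ =
  ≤-trans (s≤s (1≤degIn E m₂ t₂)) (≤-reflexive (sym (degIn-∷-incident e E t₁)))
2≤degIn (e ∷ E) (there m₁) (here refl) _ t₁ t₂ =
  ≤-trans (s≤s (1≤degIn E m₁ t₁)) (≤-reflexive (sym (degIn-∷-incident e E t₂)))
2≤degIn (e ∷ E) (there m₁) (there m₂) e₁≢e₂ t₁ t₂ =
  ≤-trans (2≤degIn E m₁ m₂ e₁≢e₂ t₁ t₂) (degIn-∷-≤ e E)

Adj-sym : ∀ {G x y} → Adj G x y → Adj G y x
Adj-sym (inj₁ m) = inj₂ m
Adj-sym (inj₂ m) = inj₁ m

Adj⇒1≤deg : ∀ {G x y} → Adj G x y → 1 ≤ deg G x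
Adj⇒1≤deg {G} {x} {y} (inj₁ m) = 1≤degIn (edges G) m (incident-fst x y)
Adj⇒1≤deg {G} {x} {y} (inj₂ m) = 1≤degIn (edges G) m (incident-snd x y)

Adj²⇒2≤deg : ∀ {G x y y′} → Adj G x y → Adj G x y′ → y ≢ y′ → 2 ≤ deg G x
Adj²⇒2≤deg {G} {x} {y} {y′} (inj₁ m) (inj₁ m′) y≢y′ =
  2≤degIn (edges G) m m′ (y≢y′ ∘ cong proj₂) (incident-fst x y) (incident-fst x y′)
Adj²⇒2≤deg {G} {x} {y} {y′} (inj₁ m) (inj₂ m′) y≢y′ =
  2≤degIn (edges G) m m′ (λ e → y≢y′ (trans (cong proj₂ e) (cong proj₁ e)))
    (incident-fst x y) (incident-snd x y′)
Adj²⇒2≤deg {G} {x} {y} {y′} (inj₂ m) (inj₁ m′) y≢y′ =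
  2≤degIn (edges G) m m′ (λ e → y≢y′ (trans (cong proj₁ e) (cong proj₂ e)))
    (incident-snd x y) (incident-fst x y′)
Adj²⇒2≤deg {G} {x} {y} {y′} (inj₂ m) (inj₂ m′) y≢y′ =
  2≤degIn (edges G) m m′ (y≢y′ ∘ cong proj₁) (incident-snd x y) (incident-snd x y′)

≤1⇒≱2 : ∀ {n} → n ≤ 1 → ¬ 2 ≤ n
≤1⇒≱2 n≤1 2≤n = <⇒≱ (s≤s n≤1) 2≤n

leaf-neighbour-unique : ∀ {G x y y′} → deg G x ≡ 1 → Adj G x y → Adj G x y′ → y ≡ y′
leaf-neighbour-unique {G} {y = y} {y′} leaf xy xy′ with y ≟ y′
... | yes y≡y′ = y≡y′
... | no y≢y′ = ⊥-elim (≤1⇒≱2 (≤-reflexive leaf) (Adj²⇒2≤deg {G} xy xy′ y≢y′))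

data AvoidingWalk (G : Graph) (z : ℕ) : ℕ → ℕ → Set where
  done : ∀ {x} → AvoidingWalk G z x x
  move : ∀ {x y w} → Adj G x y → y ≢ z → AvoidingWalk G z y w → AvoidingWalk G z x w

avoiding-snoc : ∀ {G z x y w} → AvoidingWalk G z x y → Adj G y w → w ≢ z → AvoidingWalk G z x w
avoiding-snoc done yw w≢z = move yw w≢z done
avoiding-snoc (move xy y≢z rest) yw w≢z = move xy y≢z (avoiding-snoc rest yw w≢z)

avoiding-reverse : ∀ {G z x y} → x ≢ z → AvoidingWalk G z x y → AvoidingWalk G z y x
avoiding-reverse _ done = done
avoiding-reverse {G} x≢z (move xy y≢z rest) = avoiding-snoc (avoiding-reverse y≢z rest) (Adj-sym {G} xy) x≢z

avoiding-++ : ∀ {G z x y w} → AvoidingWalk G z x y → AvoidingWalk G z y w → AvoidingWalk G z x w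
avoiding-++ done rest = rest
avoiding-++ (move xy y≢z rest) rest′ = move xy y≢z (avoiding-++ rest rest′)

avoiding-from-leaf : ∀ {G q b p} → deg G q ≡ 1 → Adj G q b → AvoidingWalk G b q p → p ≡ q
avoiding-from-leaf _ _ done = refl
avoiding-from-leaf {G} leaf qb (move qy y≢b _) = ⊥-elim (y≢b (leaf-neighbour-unique {G} leaf qy qb))

-- In a tree: a is off the path from p to q, and b is off the path from q to p.
record DegreeInversion (G : Graph) : Set where
  field
    p q a b : ℕ
    p~a : Adj G p a
    q~b : Adj G q b
    deg-q<deg-p : deg G q < deg G p
    deg-b<deg-a : deg G b < deg G a
    p⇝q : AvoidingWalk G a p q
    q⇝p : AvoidingWalk G b q p

module DegreeInversionProperties {G : Graph} (I : DegreeInversion G) where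
  open DegreeInversion I

  p≢q : p ≢ q
  p≢q p≡q = <-irrefl (cong (deg G) (sym p≡q)) deg-q<deg-p

  b≢a : b ≢ a
  b≢a b≡a = <-irrefl (cong (deg G) b≡a) deg-b<deg-a

  2≤deg-q : 2 ≤ deg G q
  2≤deg-q with m≤n⇒m<n∨m≡n (Adj⇒1≤deg {G} q~b)
  ... | inj₁ 1<deg = 1<deg
  ... | inj₂ 1≡deg = ⊥-elim (p≢q (avoiding-from-leaf (sym 1≡deg) q~b q⇝p))

  3≤deg-p : 3 ≤ deg G p
  3≤deg-p = <-≤-trans (s≤s 2≤deg-q) deg-q<deg-p

  2≤deg-a : 2 ≤ deg G a
  2≤deg-a = <-≤-trans (s≤s (Adj⇒1≤deg {G} (Adj-sym {G} q~b))) deg-b<deg-a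

∈-hang⁻ : ∀ {v m s x y} → (x , y) ∈ hang v m s → x ≡ v × s ≤ y × y < s + m
∈-hang⁻ {v} {m} {s} mem with ∈-applyUpTo⁻ (λ j → (v , s + j)) mem
... | j , j<m , refl = refl , m≤m+n s j , +-monoʳ-< s j<m

degIn-hang-centre : ∀ v m s → degIn v (hang v m s) ≡ m
degIn-hang-centre v m s = trans
  (cong length (filter-all (T? ∘ incident v) (All.tabulate incident-centre)))
  (length-applyUpTo (λ j → (v , s + j)) m)
  where
  incident-centre : ∀ {e} → e ∈ hang v m s → T (incident v e)
  incident-centre {x , y} mem with ∈-hang⁻ {v} {m} {s} mem
  ... | refl , _ = incident-fst v y

degIn-hang-isolated : ∀ v m s {w} → w ≢ v → w < s ⊎ s + m ≤ w → degIn w (hang v m s) ≡ 0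
degIn-hang-isolated v m s w≢v outside = degIn-isolated (hang v m s) λ mem →
  let x≡v , s≤y , y<s+m = ∈-hang⁻ mem in
  (λ x≡w → w≢v (trans (sym x≡w) x≡v)) ,
  (λ { refl → [ (λ y<s → <⇒≱ y<s s≤y) , (λ s+m≤y → <⇒≱ y<s+m s+m≤y) ]′ outside })

degIn-hang-leaf : ∀ v m s {w} → w ≢ v → s ≤ w → w < s + m → degIn w (hang v m s) ≡ 1
degIn-hang-leaf v zero s w≢v s≤w w<s+0 = ⊥-elim (<⇒≱ w<s+0 (subst (_≤ _) (sym (+-identityʳ s)) s≤w))
degIn-hang-leaf v (suc m) s {w} w≢v s≤w w<s+1+m = begin
  degIn w (hang v (suc m) s)                              ≡⟨ cong (degIn w) (sym (applyUpTo-∷ʳ _ m)) ⟩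
  degIn w (hang v m s ∷ʳ (v , s + m))                     ≡⟨ degIn-++ w (hang v m s) _ ⟩
  degIn w (hang v m s) + degIn w ((v , s + m) ∷ [])       ≡⟨ last-edge w<s+m∨w≡s+m ⟩
  1                                                       ∎
  where
  open ≡-Reasoning
  w<s+m∨w≡s+m : w < s + m ⊎ w ≡ s + m
  w<s+m∨w≡s+m = m≤n⇒m<n∨m≡n (≤-pred (subst (w <_) (+-suc s m) w<s+1+m))
  last-edge : w < s + m ⊎ w ≡ s + m → degIn w (hang v m s) + degIn w ((v , s + m) ∷ []) ≡ 1
  last-edge (inj₁ w<s+m) = cong₂ _+_ (degIn-hang-leaf v m s w≢v s≤w w<s+m)
    (degIn-∷-nonincident {w} (v , s + m) [] (nonincident (w≢v ∘ sym) (<⇒≢ w<s+m ∘ sym)))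
  last-edge (inj₂ refl) = cong₂ _+_ (degIn-hang-isolated v m s w≢v (inj₂ ≤-refl))
    (degIn-∷-incident {w} (v , w) [] (incident-snd w v))

stars : ℕ → List ℕ → List (ℕ × ℕ)
stars s [] = []
stars s (x ∷ xs) = (s , x ∸ 1) ∷ stars (suc s) xs

zip-applyUpTo≡stars : ∀ (f : ℕ → ℕ) s xs → (∀ j → f j ≡ s + j) →
  zip (applyUpTo f (length xs)) (map (_∸ 1) xs) ≡ stars s xs
zip-applyUpTo≡stars f s [] f≗s+ = refl
zip-applyUpTo≡stars f s (x ∷ xs) f≗s+ = cong₂ _∷_
  (cong (_, x ∸ 1) (trans (f≗s+ 0) (+-identityʳ s)))
  (zip-applyUpTo≡stars (f ∘ suc) (suc s) xs (λ j → trans (f≗s+ (suc j)) (+-suc s j)))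

pendantEdges : ℕ → List ℕ → ℕ → List (ℕ × ℕ)
pendantEdges s xs nxt = proj₁ (attach (stars s xs) nxt)

pendantEnd : ℕ → List ℕ → ℕ → ℕ
pendantEnd s xs nxt = proj₂ (attach (stars s xs) nxt)

s<s+1+n : ∀ s n → s < s + suc n
s<s+1+n s n = subst (s <_) (sym (+-suc s n)) (s≤s (m≤m+n s n))

pendantEnd-≥ : ∀ s xs nxt → nxt ≤ pendantEnd s xs nxt
pendantEnd-≥ s [] nxt = ≤-refl
pendantEnd-≥ s (x ∷ xs) nxt = ≤-trans (m≤m+n nxt (x ∸ 1)) (pendantEnd-≥ (suc s) xs (nxt + (x ∸ 1)))

∈-pendantEdges⁻ : ∀ s xs nxt {v w} → (v , w) ∈ pendantEdges s xs nxt →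
  s ≤ v × v < s + length xs × nxt ≤ w × w < pendantEnd s xs nxt
∈-pendantEdges⁻ s (x ∷ xs) nxt {v} mem with ∈-++⁻ (hang s (x ∸ 1) nxt) mem
... | inj₁ mem′ with ∈-hang⁻ {s} {x ∸ 1} {nxt} mem′
...   | refl , nxt≤w , w<end = ≤-refl , s<s+1+n s (length xs) , nxt≤w ,
                               <-≤-trans w<end (pendantEnd-≥ (suc s) xs (nxt + (x ∸ 1)))
∈-pendantEdges⁻ s (x ∷ xs) nxt {v} mem | inj₂ mem′ with ∈-pendantEdges⁻ (suc s) xs (nxt + (x ∸ 1)) mem′
...   | s<v , v<s+n , nxt′≤w , w<end = <⇒≤ s<v , subst (v <_) (sym (+-suc s (length xs))) v<s+n ,
                                       ≤-trans (m≤m+n nxt _) nxt′≤w , w<end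

pendant-parent-unique : ∀ s xs nxt {v v′ w} →
  (v , w) ∈ pendantEdges s xs nxt → (v′ , w) ∈ pendantEdges s xs nxt → v ≡ v′
pendant-parent-unique s (x ∷ xs) nxt m m′ = by-star (∈-++⁻ first m) (∈-++⁻ first m′)
  where
  first rest : List (ℕ × ℕ)
  first = hang s (x ∸ 1) nxt
  rest = pendantEdges (suc s) xs (nxt + (x ∸ 1))
  first-before-rest : ∀ {a b w} → (a , w) ∈ first → (b , w) ∈ rest → ⊥
  first-before-rest h r =
    <⇒≱ (proj₂ (proj₂ (∈-hang⁻ h))) (proj₁ (proj₂ (proj₂ (∈-pendantEdges⁻ (suc s) xs _ r))))
  by-star : ∀ {v v′ w} → (v , w) ∈ first ⊎ (v , w) ∈ rest → (v′ , w) ∈ first ⊎ (v′ , w) ∈ rest →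
            v ≡ v′
  by-star (inj₁ h) (inj₁ h′) = trans (proj₁ (∈-hang⁻ h)) (sym (proj₁ (∈-hang⁻ h′)))
  by-star (inj₁ h) (inj₂ r′) = ⊥-elim (first-before-rest h r′)
  by-star (inj₂ r) (inj₁ h′) = ⊥-elim (first-before-rest h′ r)
  by-star (inj₂ r) (inj₂ r′) = pendant-parent-unique (suc s) xs _ r r′

degIn-pendantEdges-isolated : ∀ s xs nxt {v} →
  v < s ⊎ s + length xs ≤ v → v < nxt ⊎ pendantEnd s xs nxt ≤ v → degIn v (pendantEdges s xs nxt) ≡ 0
degIn-pendantEdges-isolated s xs nxt {v} not-centre not-leaf = degIn-isolated (pendantEdges s xs nxt) λ mem →
  let s≤x , x<s+n , nxt≤y , y<end = ∈-pendantEdges⁻ s xs nxt mem in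
  (λ { refl → [ (λ v<s → <⇒≱ v<s s≤x) , (λ s+n≤v → <⇒≱ x<s+n s+n≤v) ]′ not-centre }) ,
  (λ { refl → [ (λ v<nxt → <⇒≱ v<nxt nxt≤y) , (λ end≤v → <⇒≱ y<end end≤v) ]′ not-leaf })

degIn-pendantEdges-centre : ∀ s xs nxt {v} → s + length xs ≤ nxt → s ≤ v → v < s + length xs →
  ∃[ d ] (d ∈ xs × degIn v (pendantEdges s xs nxt) ≡ d ∸ 1)
degIn-pendantEdges-centre s [] nxt {v} _ s≤v v<s+0 =
  ⊥-elim (<⇒≱ v<s+0 (subst (_≤ v) (sym (+-identityʳ s)) s≤v))
degIn-pendantEdges-centre s (x ∷ xs) nxt {v} s+n≤nxt s≤v v<s+n
  rewrite degIn-++ v (hang s (x ∸ 1) nxt) (pendantEdges (suc s) xs (nxt + (x ∸ 1))) with s ≟ v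
... | yes refl = x , here refl , trans (cong₂ _+_ (degIn-hang-centre s (x ∸ 1) nxt) rest-deg) (+-identityʳ _)
  where
  s<nxt : s < nxt
  s<nxt = <-≤-trans (s<s+1+n s (length xs)) s+n≤nxt
  rest-deg : degIn s (pendantEdges (suc s) xs (nxt + (x ∸ 1))) ≡ 0
  rest-deg = degIn-pendantEdges-isolated (suc s) xs _ (inj₁ ≤-refl) (inj₁ (<-≤-trans s<nxt (m≤m+n nxt _)))
... | no s≢v with degIn-pendantEdges-centre (suc s) xs (nxt + (x ∸ 1))
                    (≤-trans (≤-reflexive (sym (+-suc s (length xs)))) (≤-trans s+n≤nxt (m≤m+n nxt _)))
                    (≤∧≢⇒< s≤v s≢v) (subst (v <_) (+-suc s (length xs)) v<s+n)
...   | d , d∈xs , deg≡ = d , there d∈xs , trans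
        (cong (_+ degIn v (pendantEdges (suc s) xs (nxt + (x ∸ 1))))
              (degIn-hang-isolated s (x ∸ 1) nxt (s≢v ∘ sym) (inj₁ (<-≤-trans v<s+n s+n≤nxt))))
        deg≡

degIn-pendantEdges-leaf : ∀ s xs nxt {w} → s + length xs ≤ nxt → nxt ≤ w → w < pendantEnd s xs nxt →
  degIn w (pendantEdges s xs nxt) ≡ 1
degIn-pendantEdges-leaf s [] nxt _ nxt≤w w<nxt = ⊥-elim (<⇒≱ w<nxt nxt≤w)
degIn-pendantEdges-leaf s (x ∷ xs) nxt {w} s+n≤nxt nxt≤w w<end =
  trans (degIn-++ w (hang s (x ∸ 1) nxt) (pendantEdges (suc s) xs nxt′)) (split (w <? nxt′))
  where
  nxt′ : ℕ
  nxt′ = nxt + (x ∸ 1)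
  s+n′≤nxt : suc s + length xs ≤ nxt
  s+n′≤nxt = ≤-trans (≤-reflexive (sym (+-suc s (length xs)))) s+n≤nxt
  w≢s : w ≢ s
  w≢s refl = <⇒≱ (<-≤-trans (s<s+1+n s (length xs)) s+n≤nxt) nxt≤w
  split : Dec (w < nxt′) → degIn w (hang s (x ∸ 1) nxt) + degIn w (pendantEdges (suc s) xs nxt′) ≡ 1
  split (yes w<nxt′) = cong₂ _+_ (degIn-hang-leaf s (x ∸ 1) nxt w≢s nxt≤w w<nxt′)
    (degIn-pendantEdges-isolated (suc s) xs nxt′ (inj₂ (≤-trans s+n′≤nxt nxt≤w)) (inj₁ w<nxt′))
  split (no w≮nxt′) = cong₂ _+_ (degIn-hang-isolated s (x ∸ 1) nxt w≢s (inj₂ (≮⇒≥ w≮nxt′)))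
    (degIn-pendantEdges-leaf (suc s) xs nxt′ (≤-trans s+n′≤nxt (m≤m+n nxt _)) (≮⇒≥ w≮nxt′) w<end)

EdgesInRange : Graph → Set
EdgesInRange G = ∀ {x y} → (x , y) ∈ edges G → x < size G × y < size G

Adj-in-range : ∀ {G x y} → EdgesInRange G → Adj G x y → x < size G × y < size G
Adj-in-range in-range (inj₁ mem) = in-range mem
Adj-in-range in-range (inj₂ mem) = Product.swap (in-range mem)

-- graft G u k xs gives u the new children s, …, s + k - 1 (s = size G); child s + i with
-- i < length xs gets xs[i] - 1 leaves, numbered from s + k on.  Both cases of M(D) are grafts
-- by definition: caseI ds dt = graft (mkGraph 1 []) 0 dt ds, caseII G u xs = graft G u (length xs) xs.
graft : Graph → ℕ → ℕ → List ℕ → Graph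
graft G u k xs = mkGraph (proj₂ r) (edges G ++ hang u k (size G) ++ proj₁ r)
  where r = attach (zip (applyUpTo (size G +_) (length xs)) (map (_∸ 1) xs)) (size G + k)

module Graft (G : Graph) (u k : ℕ) (xs : List ℕ) (G-in-range : EdgesInRange G)
  (u<s : u < size G) (n≤k : length xs ≤ k) (xs-positive : All (1 ≤_) xs) where

  s n end : ℕ
  s = size G
  n = length xs
  end = pendantEnd s xs (s + k)

  G⁺ : Graph
  G⁺ = graft G u k xs

  pendants : List (ℕ × ℕ)
  pendants = pendantEdges s xs (s + k)

  Inner : ℕ → Set
  Inner v = s ≤ v × v < s + n

  s+n≤s+k : s + n ≤ s + k
  s+n≤s+k = +-monoʳ-≤ s n≤k

  s+k≤end : s + k ≤ end
  s+k≤end = pendantEnd-≥ s xs (s + k)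

  pendant-parent-inner : ∀ {v w} → (v , w) ∈ pendants → Inner v
  pendant-parent-inner mem = let s≤v , v<s+n , _ = ∈-pendantEdges⁻ s xs (s + k) mem in s≤v , v<s+n

  pendant-beyond-children : ∀ {v w} → (v , w) ∈ pendants → s + k ≤ w
  pendant-beyond-children mem = proj₁ (proj₂ (proj₂ (∈-pendantEdges⁻ s xs (s + k) mem)))

  pendant-below-end : ∀ {v w} → (v , w) ∈ pendants → w < end
  pendant-below-end mem = proj₂ (proj₂ (proj₂ (∈-pendantEdges⁻ s xs (s + k) mem)))

  pendant-outer : ∀ {v w} → (v , w) ∈ pendants → s + n ≤ w
  pendant-outer mem = ≤-trans s+n≤s+k (pendant-beyond-children mem)

  outer-new : ∀ {v} → s + n ≤ v → s ≤ v
  outer-new = ≤-trans (m≤m+n s n)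

  new≢u : ∀ {v} → s ≤ v → v ≢ u
  new≢u s≤v refl = <⇒≱ u<s s≤v

  edges-G⁺ : edges G⁺ ≡ edges G ++ hang u k s ++ pendants
  edges-G⁺ = cong (λ Z → edges G ++ hang u k s ++ proj₁ (attach Z (s + k)))
                  (zip-applyUpTo≡stars (s +_) s xs (λ _ → refl))

  size-G⁺ : size G⁺ ≡ end
  size-G⁺ = cong (λ Z → proj₂ (attach Z (s + k))) (zip-applyUpTo≡stars (s +_) s xs (λ _ → refl))

  deg-G⁺ : ∀ v → deg G⁺ v ≡ degIn v (edges G) + (degIn v (hang u k s) + degIn v pendants)
  deg-G⁺ v = trans (cong (degIn v) edges-G⁺)
    (trans (degIn-++ v (edges G) _) (cong (degIn v (edges G) +_) (degIn-++ v (hang u k s) pendants)))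

  degIn-G-new : ∀ {v} → s ≤ v → degIn v (edges G) ≡ 0
  degIn-G-new s≤v = degIn-isolated (edges G) λ mem →
    (λ { refl → <⇒≱ (proj₁ (G-in-range mem)) s≤v }) ,
    (λ { refl → <⇒≱ (proj₂ (G-in-range mem)) s≤v })

  deg-mono : ∀ v → deg G v ≤ deg G⁺ v
  deg-mono v = ≤-trans (m≤m+n _ _) (≤-reflexive (sym (deg-G⁺ v)))

  deg-old : ∀ {v} → v < s → v ≢ u → deg G⁺ v ≡ deg G v
  deg-old {v} v<s v≢u = trans (deg-G⁺ v) (trans (cong (deg G v +_) (cong₂ _+_
    (degIn-hang-isolated u k s v≢u (inj₁ v<s))
    (degIn-pendantEdges-isolated s xs (s + k) (inj₁ v<s) (inj₁ (<-≤-trans v<s (m≤m+n s k))))))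
    (+-identityʳ _))

  deg-root : deg G⁺ u ≡ deg G u + k
  deg-root = trans (deg-G⁺ u) (cong (deg G u +_) (trans (cong₂ _+_
    (degIn-hang-centre u k s)
    (degIn-pendantEdges-isolated s xs (s + k) (inj₁ u<s) (inj₁ (<-≤-trans u<s (m≤m+n s k)))))
    (+-identityʳ k)))

  deg-inner : ∀ {v} → Inner v → ∃[ d ] (d ∈ xs × deg G⁺ v ≡ d)
  deg-inner {v} (s≤v , v<s+n) with degIn-pendantEdges-centre s xs (s + k) s+n≤s+k s≤v v<s+n
  ... | d , d∈xs , pendant-deg = d , d∈xs , (begin
    deg G⁺ v
      ≡⟨ deg-G⁺ v ⟩
    degIn v (edges G) + (degIn v (hang u k s) + degIn v pendants)
      ≡⟨ cong₂ _+_ (degIn-G-new s≤v) (cong₂ _+_ hang-deg pendant-deg) ⟩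
    1 + (d ∸ 1)
      ≡⟨ m+[n∸m]≡n (All.lookup xs-positive d∈xs) ⟩
    d ∎)
    where
    open ≡-Reasoning
    hang-deg : degIn v (hang u k s) ≡ 1
    hang-deg = degIn-hang-leaf u k s (new≢u s≤v) s≤v (<-≤-trans v<s+n s+n≤s+k)

  deg-outer : ∀ {v} → s + n ≤ v → deg G⁺ v ≤ 1
  deg-outer {v} s+n≤v = ≤-trans (≤-reflexive (trans (deg-G⁺ v) (cong (_+ new-deg) (degIn-G-new s≤v)))) by-range
    where
    s≤v : s ≤ v
    s≤v = outer-new s+n≤v
    new-deg : ℕ
    new-deg = degIn v (hang u k s) + degIn v pendants
    hang-isolated : s + k ≤ v → degIn v (hang u k s) ≡ 0
    hang-isolated = degIn-hang-isolated u k s (new≢u s≤v) ∘ inj₂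
    pendants-isolated : v < s + k ⊎ end ≤ v → degIn v pendants ≡ 0
    pendants-isolated = degIn-pendantEdges-isolated s xs (s + k) (inj₂ s+n≤v)
    by-range : new-deg ≤ 1
    by-range with v <? s + k | v <? end
    ... | yes v<s+k | _ = ≤-reflexive (cong₂ _+_
          (degIn-hang-leaf u k s (new≢u s≤v) s≤v v<s+k)
          (pendants-isolated (inj₁ v<s+k)))
    ... | no v≮s+k | yes v<end = ≤-reflexive (cong₂ _+_
          (hang-isolated (≮⇒≥ v≮s+k))
          (degIn-pendantEdges-leaf s xs (s + k) s+n≤s+k (≮⇒≥ v≮s+k) v<end))
    ... | no v≮s+k | no v≮end = ≤-trans (≤-reflexive (cong₂ _+_
          (hang-isolated (≮⇒≥ v≮s+k))
          (pendants-isolated (inj₂ (≮⇒≥ v≮end))))) z≤n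

  data Position (v : ℕ) : Set where
    old   : v < s → Position v
    inner : Inner v → Position v
    outer : s + n ≤ v → Position v

  position : ∀ v → Position v
  position v with v <? s | v <? s + n
  ... | yes v<s | _ = old v<s
  ... | no v≮s | yes v<s+n = inner (≮⇒≥ v≮s , v<s+n)
  ... | no _ | no v≮s+n = outer (≮⇒≥ v≮s+n)

  Adj-G-in-range : ∀ {x y} → Adj G x y → x < s × y < s
  Adj-G-in-range = Adj-in-range {G} G-in-range

  G⁺-in-range : EdgesInRange G⁺
  G⁺-in-range {x} {y} mem rewrite size-G⁺ with ∈-++⁻ (edges G) (subst ((x , y) ∈_) edges-G⁺ mem)
  ... | inj₁ old-mem = let x<s , y<s = G-in-range old-mem in <-≤-trans x<s s≤end , <-≤-trans y<s s≤end
    where s≤end : s ≤ end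
          s≤end = ≤-trans (m≤m+n s k) s+k≤end
  ... | inj₂ new-mem with ∈-++⁻ (hang u k s) new-mem
  ...   | inj₁ hang-mem = let x≡u , _ , y<s+k = ∈-hang⁻ {u} {k} {s} hang-mem in
          <-≤-trans (subst (_< s) (sym x≡u) u<s) (≤-trans (m≤m+n s k) s+k≤end) , <-≤-trans y<s+k s+k≤end
  ...   | inj₂ pendant-mem = <-≤-trans (proj₂ (pendant-parent-inner pendant-mem)) (≤-trans s+n≤s+k s+k≤end) ,
                             pendant-below-end pendant-mem

  data GraftAdj (x y : ℕ) : Set where
    old-edge       : Adj G x y → GraftAdj x y
    root-child     : x ≡ u → s ≤ y → y < s + k → GraftAdj x y
    child-root     : y ≡ u → s ≤ x → x < s + k → GraftAdj x y
    centre-pendant : (x , y) ∈ pendants → GraftAdj x y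
    pendant-centre : (y , x) ∈ pendants → GraftAdj x y

  graft-adj : ∀ {x y} → Adj G⁺ x y → GraftAdj x y
  graft-adj {x} {y} (inj₁ mem) with ∈-++⁻ (edges G) (subst ((x , y) ∈_) edges-G⁺ mem)
  ... | inj₁ old-mem = old-edge (inj₁ old-mem)
  ... | inj₂ new-mem with ∈-++⁻ (hang u k s) new-mem
  ...   | inj₁ hang-mem = let x≡u , s≤y , y<s+k = ∈-hang⁻ {u} {k} {s} hang-mem in
                          root-child x≡u s≤y y<s+k
  ...   | inj₂ pendant-mem = centre-pendant pendant-mem
  graft-adj {x} {y} (inj₂ mem) with ∈-++⁻ (edges G) (subst ((y , x) ∈_) edges-G⁺ mem)
  ... | inj₁ old-mem = old-edge (inj₂ old-mem)
  ... | inj₂ new-mem with ∈-++⁻ (hang u k s) new-mem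
  ...   | inj₁ hang-mem = let y≡u , s≤x , x<s+k = ∈-hang⁻ {u} {k} {s} hang-mem in
                          child-root y≡u s≤x x<s+k
  ...   | inj₂ pendant-mem = pendant-centre pendant-mem

  old-neighbour : ∀ {x y} → x < s → x ≢ u → Adj G⁺ x y → Adj G x y
  old-neighbour x<s x≢u xy with graft-adj xy
  ... | old-edge xy′ = xy′
  ... | root-child x≡u _ _ = ⊥-elim (x≢u x≡u)
  ... | child-root _ s≤x _ = ⊥-elim (<⇒≱ x<s s≤x)
  ... | centre-pendant m = ⊥-elim (<⇒≱ x<s (proj₁ (pendant-parent-inner m)))
  ... | pendant-centre m = ⊥-elim (<⇒≱ x<s (outer-new (pendant-outer m)))

  root-neighbour : ∀ {y} → Adj G⁺ u y → Adj G u y ⊎ (s ≤ y × y < s + k)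
  root-neighbour uy with graft-adj uy
  ... | old-edge uy′ = inj₁ uy′
  ... | root-child _ s≤y y<s+k = inj₂ (s≤y , y<s+k)
  ... | child-root _ s≤u _ = ⊥-elim (<⇒≱ u<s s≤u)
  ... | centre-pendant m = ⊥-elim (<⇒≱ u<s (proj₁ (pendant-parent-inner m)))
  ... | pendant-centre m = ⊥-elim (<⇒≱ u<s (outer-new (pendant-outer m)))

  inner-neighbour : ∀ {x y} → Inner x → Adj G⁺ x y → y ≡ u ⊎ (x , y) ∈ pendants
  inner-neighbour (s≤x , x<s+n) xy with graft-adj xy
  ... | old-edge xy′ = ⊥-elim (<⇒≱ (proj₁ (Adj-G-in-range xy′)) s≤x)
  ... | root-child x≡u _ _ = ⊥-elim (new≢u s≤x x≡u)
  ... | child-root y≡u _ _ = inj₁ y≡u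
  ... | centre-pendant m = inj₂ m
  ... | pendant-centre m = ⊥-elim (<⇒≱ x<s+n (pendant-outer m))

  outer-neighbour : ∀ {x y} → s + n ≤ x → Adj G⁺ x y → y ≡ u ⊎ Inner y
  outer-neighbour s+n≤x xy with graft-adj xy
  ... | old-edge xy′ = ⊥-elim (<⇒≱ (proj₁ (Adj-G-in-range xy′)) (outer-new s+n≤x))
  ... | root-child x≡u _ _ = ⊥-elim (new≢u (outer-new s+n≤x) x≡u)
  ... | child-root y≡u _ _ = inj₁ y≡u
  ... | centre-pendant m = ⊥-elim (<⇒≱ (proj₂ (pendant-parent-inner m)) s+n≤x)
  ... | pendant-centre m = inj₂ (pendant-parent-inner m)

  pendant-neighbour : ∀ {x c y} → (x , c) ∈ pendants → Adj G⁺ c y → y ≡ x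
  pendant-neighbour xc cy with graft-adj cy
  ... | old-edge cy′ = ⊥-elim (<⇒≱ (proj₁ (Adj-G-in-range cy′)) (outer-new (pendant-outer xc)))
  ... | root-child c≡u _ _ = ⊥-elim (new≢u (outer-new (pendant-outer xc)) c≡u)
  ... | child-root _ _ c<s+k = ⊥-elim (<⇒≱ c<s+k (pendant-beyond-children xc))
  ... | centre-pendant m = ⊥-elim (<⇒≱ (proj₂ (pendant-parent-inner m)) (pendant-outer xc))
  ... | pendant-centre m = pendant-parent-unique s xs (s + k) m xc

  inner-star : ∀ {x t} → Inner x → AvoidingWalk G⁺ u x t → t ≡ x ⊎ (x , t) ∈ pendants
  inner-star {x} x-inner = go (inj₁ refl)
    where
    go : ∀ {c t} → c ≡ x ⊎ (x , c) ∈ pendants → AvoidingWalk G⁺ u c t → t ≡ x ⊎ (x , t) ∈ pendants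
    go at-c done = at-c
    go (inj₁ refl) (move xy y≢u rest) with inner-neighbour x-inner xy
    ... | inj₁ y≡u = ⊥-elim (y≢u y≡u)
    ... | inj₂ m = go (inj₂ m) rest
    go (inj₂ m) (move cy _ rest) = go (inj₁ (pendant-neighbour m cy)) rest

  -- A walk of G⁺ that ends in G can only enter G through u.
  restrict : ∀ {z x t} → AvoidingWalk G⁺ z x t → t < s →
    (x < s → AvoidingWalk G z x t) × (s ≤ x → u ≢ z × AvoidingWalk G z u t)
  restrict done t<s = (λ _ → done) , (λ s≤t → ⊥-elim (<⇒≱ t<s s≤t))
  restrict (move xy y≢z rest) t<s with restrict rest t<s | graft-adj xy
  ... | from-old , _ | old-edge xy′ =
        (λ _ → move xy′ y≢z (from-old (proj₂ (Adj-G-in-range xy′)))) ,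
        (λ s≤x → ⊥-elim (<⇒≱ (proj₁ (Adj-G-in-range xy′)) s≤x))
  ... | _ , from-new | root-child refl s≤y _ =
        (λ _ → proj₂ (from-new s≤y)) , (λ s≤u → ⊥-elim (<⇒≱ u<s s≤u))
  ... | from-old , _ | child-root refl s≤x _ =
        (λ x<s → ⊥-elim (<⇒≱ x<s s≤x)) , (λ _ → y≢z , from-old u<s)
  ... | _ , from-new | centre-pendant m =
        (λ x<s → ⊥-elim (<⇒≱ x<s (proj₁ (pendant-parent-inner m)))) ,
        (λ _ → from-new (outer-new (pendant-outer m)))
  ... | _ , from-new | pendant-centre m =
        (λ x<s → ⊥-elim (<⇒≱ x<s (outer-new (pendant-outer m)))) ,
        (λ _ → from-new (proj₁ (pendant-parent-inner m)))

  restrict-old : ∀ {z x t} → AvoidingWalk G⁺ z x t → x < s → t < s → AvoidingWalk G z x t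
  restrict-old w x<s t<s = proj₁ (restrict w t<s) x<s

  inversion-position : (I : DegreeInversion G⁺) → let open DegreeInversion I in p < s × (q < s ⊎ Inner q)
  inversion-position I = p-old (position p) , q-not-outer (position q)
    where
    open DegreeInversion I
    open DegreeInversionProperties I
    p-old : Position p → p < s
    p-old (old p<s) = p<s
    p-old (outer s+n≤p) = ⊥-elim (<⇒≱ (s≤s (deg-outer s+n≤p)) (≤-trans (s≤s (s≤s z≤n)) 3≤deg-p))
    p-old (inner p-inner) with inner-neighbour p-inner p~a
    ... | inj₂ m = ⊥-elim (≤1⇒≱2 (deg-outer (pendant-outer m)) 2≤deg-a)
    ... | inj₁ refl with inner-star p-inner p⇝q
    ...   | inj₁ q≡p = ⊥-elim (p≢q (sym q≡p))
    ...   | inj₂ m = ⊥-elim (≤1⇒≱2 (deg-outer (pendant-outer m)) 2≤deg-q)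
    q-not-outer : Position q → q < s ⊎ Inner q
    q-not-outer (old q<s) = inj₁ q<s
    q-not-outer (inner q-inner) = inj₂ q-inner
    q-not-outer (outer s+n≤q) = ⊥-elim (≤1⇒≱2 (deg-outer s+n≤q) 2≤deg-q)

  restrict-inversion : (I : DegreeInversion G⁺) → let open DegreeInversion I in
    p < s → p ≢ u → q < s → q ≢ u → a ≢ u → DegreeInversion G
  restrict-inversion I p<s p≢u q<s q≢u a≢u = record
    { p~a = p~a′ ; q~b = q~b′
    ; deg-q<deg-p = subst₂ _<_ (deg-old q<s q≢u) (deg-old p<s p≢u) deg-q<deg-p
    ; deg-b<deg-a = <-≤-trans (s≤s (deg-mono b)) (subst (deg G⁺ b <_) (deg-old a<s a≢u) deg-b<deg-a)
    ; p⇝q = restrict-old p⇝q p<s q<s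
    ; q⇝p = restrict-old q⇝p q<s p<s
    }
    where
    open DegreeInversion I
    p~a′ : Adj G p a
    p~a′ = old-neighbour p<s p≢u p~a
    q~b′ : Adj G q b
    q~b′ = old-neighbour q<s q≢u q~b
    a<s : a < s
    a<s = proj₂ (Adj-G-in-range p~a′)

-- The invariant of the alternating greedy construction

AllPairs-++⁻ : ∀ {A : Set} {R : A → A → Set} xs {ys} → AllPairs R (xs ++ ys) →
  AllPairs R xs × AllPairs R ys × All (λ x → All (R x) ys) xs
AllPairs-++⁻ [] R-ys = [] , R-ys , []
AllPairs-++⁻ (x ∷ xs) (R-x ∷ R-xs++ys) =
  let R-xs , R-ys , R-xs-ys = AllPairs-++⁻ xs R-xs++ys
      R-x-xs , R-x-ys = AllP.++⁻ xs R-x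
  in R-x-xs ∷ R-xs , R-ys , R-x-ys ∷ R-xs-ys

Nonincreasing : List ℕ → Set
Nonincreasing = AllPairs (λ a b → b ≤ a)

record GreedyInvariant (D : List ℕ) (G : Graph) (L : List ℕ) : Set where
  field
    in-range                 : EdgesInRange G
    degree-in-D              : ∀ v → deg G v ≤ 1 ⊎ deg G v ∈ D
    labels-sorted            : AllPairs (λ x y → deg G x ≤ deg G y) L
    labels-internal          : All (λ v → 2 ≤ deg G v) L
    leaf-neighbours-labelled : ∀ v → AdjLeaf G v → v ∈ L
    no-inversion             : ¬ DegreeInversion G

module Base (ds : List ℕ) (dt : ℕ) (X : List ℕ) (t≤1+dt : length ds ≤ dt)
  (X-labels : X ↭ applyUpTo suc (length ds)) (X-sorted : NondecDeg (caseI ds dt) X)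
  (D-sorted : Nonincreasing (ds ++ dt ∷ [])) (D≥2 : All (2 ≤_) (ds ++ dt ∷ [])) where

  ds≥dt : All (dt ≤_) ds
  ds≥dt = All.map (λ { (dt≤d ∷ []) → dt≤d }) (proj₂ (proj₂ (AllPairs-++⁻ ds D-sorted)))

  ds≥2 : All (2 ≤_) ds
  ds≥2 = AllP.++⁻ˡ ds D≥2

  dt≥2 : 2 ≤ dt
  dt≥2 = All.head (AllP.++⁻ʳ ds D≥2)

  open Graft (mkGraph 1 []) 0 dt ds (λ ()) (s≤s z≤n) t≤1+dt (All.map (≤-trans (s≤s z≤n)) ds≥2)

  old≡0 : ∀ {v} → v < 1 → v ≡ 0
  old≡0 (s≤s z≤n) = refl

  inner-deg : ∀ {v} → Inner v → dt ≤ deg G⁺ v × 2 ≤ deg G⁺ v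
  inner-deg v-inner with deg-inner v-inner
  ... | d , d∈ds , refl = All.lookup ds≥dt d∈ds , All.lookup ds≥2 d∈ds

  deg-centre : deg G⁺ 0 ≡ dt
  deg-centre = deg-root

  centre≤inner : ∀ {v} → Inner v → deg G⁺ 0 ≤ deg G⁺ v
  centre≤inner {v} v-inner = subst (_≤ deg G⁺ v) (sym deg-centre) (proj₁ (inner-deg v-inner))

  X-inner : ∀ {x} → x ∈ X → Inner x
  X-inner x∈X with ∈-applyUpTo⁻ suc (∈-resp-↭ X-labels x∈X)
  ... | i , i<n , refl = s≤s z≤n , s≤s i<n

  inner-label : ∀ {v} → Inner v → v ∈ X
  inner-label (s≤s z≤n , s≤s i<n) = ∈-resp-↭ (↭-sym X-labels) (∈-applyUpTo⁺ suc i<n)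

  degree-in-D : ∀ v → deg G⁺ v ≤ 1 ⊎ deg G⁺ v ∈ ds ++ dt ∷ []
  degree-in-D v with position v
  ... | old v<1 rewrite old≡0 v<1 = inj₂ (∈-++⁺ʳ ds (here deg-centre))
  ... | inner v-inner = let d , d∈ds , deg≡d = deg-inner v-inner in
                        inj₂ (∈-++⁺ˡ (subst (_∈ ds) (sym deg≡d) d∈ds))
  ... | outer 1+n≤v = inj₁ (deg-outer 1+n≤v)

  labels-sorted : AllPairs (λ x y → deg G⁺ x ≤ deg G⁺ y) (0 ∷ X)
  labels-sorted = All.tabulate (centre≤inner ∘ X-inner)
                ∷ Linked⇒AllPairs ≤-trans X-sorted

  labels-internal : All (λ v → 2 ≤ deg G⁺ v) (0 ∷ X)
  labels-internal = subst (2 ≤_) (sym deg-centre) dt≥2 ∷ All.tabulate (proj₂ ∘ inner-deg ∘ X-inner)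

  leaf-neighbours-labelled : ∀ v → AdjLeaf G⁺ v → v ∈ 0 ∷ X
  leaf-neighbours-labelled v (w , w-leaf , v~w) with position v
  ... | old v<1 = here (old≡0 v<1)
  ... | inner v-inner = there (inner-label v-inner)
  ... | outer 1+n≤v with outer-neighbour 1+n≤v v~w
  ...   | inj₁ refl = ⊥-elim (≤1⇒≱2 (≤-reflexive w-leaf) (subst (2 ≤_) (sym deg-centre) dt≥2))
  ...   | inj₂ w-inner = ⊥-elim (≤1⇒≱2 (≤-reflexive w-leaf) (proj₂ (inner-deg w-inner)))

  no-inversion : ¬ DegreeInversion G⁺
  no-inversion I with inversion-position I
  ... | p<1 , inj₁ q<1 = p≢q (trans (old≡0 p<1) (sym (old≡0 q<1)))
    where open DegreeInversionProperties I
  ... | p<1 , inj₂ q-inner =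
    <⇒≱ deg-q<deg-p (subst (λ c → deg G⁺ c ≤ deg G⁺ q) (sym (old≡0 p<1)) (centre≤inner q-inner))
    where open DegreeInversion I

  invariant : GreedyInvariant (ds ++ dt ∷ []) G⁺ (0 ∷ X)
  invariant = record
    { in-range = G⁺-in-range ; degree-in-D = degree-in-D ; labels-sorted = labels-sorted
    ; labels-internal = labels-internal ; leaf-neighbours-labelled = leaf-neighbours-labelled
    ; no-inversion = no-inversion }

module Step (xs D′ : List ℕ) (dt : ℕ) (G′ : Graph) (L′ pre : List ℕ) (vₛ : ℕ) (post : List ℕ) (u : ℕ)
  (X : List ℕ) (k≡dt-1 : length xs ≡ dt ∸ 1) (ih : GreedyInvariant D′ G′ L′)
  (L′≡ : L′ ≡ pre ++ vₛ ∷ post) (pre-no-leaf : All (λ v → ¬ AdjLeaf G′ v) pre)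
  (u-leaf : deg G′ u ≡ 1) (vₛ~u : Adj G′ vₛ u)
  (X-labels : X ↭ applyUpTo (size G′ +_) (length xs)) (X-sorted : NondecDeg (caseII G′ u xs) X)
  (D-sorted : Nonincreasing (xs ++ D′ ++ dt ∷ [])) (D≥2 : All (2 ≤_) (xs ++ D′ ++ dt ∷ [])) where

  module IH = GreedyInvariant ih

  D″ : List ℕ
  D″ = D′ ++ dt ∷ []

  xs≥D″ : All (λ x → All (_≤ x) D″) xs
  xs≥D″ = proj₂ (proj₂ (AllPairs-++⁻ xs D-sorted))

  D″-sorted : Nonincreasing D″
  D″-sorted = proj₁ (proj₂ (AllPairs-++⁻ xs D-sorted))

  D″≥dt : All (dt ≤_) D″
  D″≥dt = AllP.++⁺ (All.map (λ { (dt≤e ∷ []) → dt≤e }) (proj₂ (proj₂ (AllPairs-++⁻ D′ D″-sorted))))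
                   (≤-refl ∷ [])

  dt≥2 : 2 ≤ dt
  dt≥2 = All.head (AllP.++⁻ʳ D′ (AllP.++⁻ʳ xs D≥2))

  u<s : u < size G′
  u<s = proj₂ (Adj-in-range {G′} IH.in-range vₛ~u)

  open Graft G′ u (length xs) xs IH.in-range u<s ≤-refl (All.map (≤-trans (s≤s z≤n)) (AllP.++⁻ˡ xs D≥2))

  deg-u : deg G⁺ u ≡ dt
  deg-u = trans deg-root (trans (cong₂ _+_ u-leaf k≡dt-1) (m+[n∸m]≡n (≤-trans (s≤s z≤n) dt≥2)))

  inner-dominates : ∀ {v} → Inner v → All (_≤ deg G⁺ v) D″
  inner-dominates v-inner with deg-inner v-inner
  ... | d , d∈xs , refl = All.lookup xs≥D″ d∈xs

  inner-internal : ∀ {v} → Inner v → 2 ≤ deg G⁺ v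
  inner-internal v-inner = ≤-trans dt≥2 (All.lookup (inner-dominates v-inner) (∈-++⁺ʳ D′ (here refl)))

  internal-old-deg : ∀ {v} → v < s → 2 ≤ deg G⁺ v → deg G⁺ v ∈ D″
  internal-old-deg {v} v<s 2≤deg with v ≟ u
  ... | yes refl = ∈-++⁺ʳ D′ (here deg-u)
  ... | no v≢u with IH.degree-in-D v
  ...   | inj₁ deg≤1 = ⊥-elim (≤1⇒≱2 (≤-trans (≤-reflexive (deg-old v<s v≢u)) deg≤1) 2≤deg)
  ...   | inj₂ deg∈D′ = ∈-++⁺ˡ (subst (_∈ D′) (sym (deg-old v<s v≢u)) deg∈D′)

  old-below-inner : ∀ {v x} → v < s → 2 ≤ deg G⁺ v → Inner x → deg G⁺ v ≤ deg G⁺ x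
  old-below-inner v<s 2≤deg x-inner = All.lookup (inner-dominates x-inner) (internal-old-deg v<s 2≤deg)

  root-below-old : ∀ {v} → v < s → 2 ≤ deg G⁺ v → deg G⁺ u ≤ deg G⁺ v
  root-below-old v<s 2≤deg = subst (_≤ _) (sym deg-u) (All.lookup D″≥dt (internal-old-deg v<s 2≤deg))

  leaf≢u : ∀ {w} → deg G⁺ w ≡ 1 → w ≢ u
  leaf≢u w-leaf refl = ≤1⇒≱2 (≤-reflexive w-leaf) (subst (2 ≤_) (sym deg-u) dt≥2)

  label-old : ∀ {v} → v ∈ L′ → v < s × v ≢ u
  label-old {v} v∈L′ = v<s , λ { refl → ≤1⇒≱2 (≤-reflexive u-leaf) 2≤deg }
    where
    2≤deg : 2 ≤ deg G′ v
    2≤deg = All.lookup IH.labels-internal v∈L′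
    v<s : v < s
    v<s with v <? s
    ... | yes v<s = v<s
    ... | no v≮s = ⊥-elim (≤1⇒≱2 (≤-trans (≤-reflexive (degIn-G-new (≮⇒≥ v≮s))) z≤n) 2≤deg)

  label-deg : ∀ {v} → v ∈ L′ → deg G⁺ v ≡ deg G′ v
  label-deg v∈L′ = let v<s , v≢u = label-old v∈L′ in deg-old v<s v≢u

  label-internal : ∀ {v} → v ∈ L′ → 2 ≤ deg G⁺ v
  label-internal v∈L′ = subst (2 ≤_) (sym (label-deg v∈L′)) (All.lookup IH.labels-internal v∈L′)

  vₛ∈L′ : vₛ ∈ L′
  vₛ∈L′ = subst (vₛ ∈_) (sym L′≡) (∈-++⁺ʳ pre (here refl))

  X-inner : ∀ {x} → x ∈ X → Inner x
  X-inner x∈X with ∈-applyUpTo⁻ (s +_) (∈-resp-↭ X-labels x∈X)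
  ... | i , i<n , refl = m≤m+n s i , +-monoʳ-< s i<n

  inner-label : ∀ {v} → Inner v → v ∈ X
  inner-label {v} (s≤v , v<s+n) =
    ∈-resp-↭ (↭-sym X-labels) (subst (_∈ _) s+[v∸s]≡v (∈-applyUpTo⁺ (s +_) i<n))
    where
    s+[v∸s]≡v : s + (v ∸ s) ≡ v
    s+[v∸s]≡v = m+[n∸m]≡n s≤v
    i<n : v ∸ s < n
    i<n = +-cancelˡ-< s (v ∸ s) n (subst (_< s + n) (sym s+[v∸s]≡v) v<s+n)

  degree-in-D : ∀ v → deg G⁺ v ≤ 1 ⊎ deg G⁺ v ∈ xs ++ D″
  degree-in-D v with deg G⁺ v ≤? 1 | position v
  ... | yes deg≤1 | _ = inj₁ deg≤1
  ... | no deg≰1 | old v<s = inj₂ (∈-++⁺ʳ xs (internal-old-deg v<s (≰⇒> deg≰1)))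
  ... | no _ | inner v-inner = let d , d∈xs , deg≡d = deg-inner v-inner in
                               inj₂ (∈-++⁺ˡ (subst (_∈ xs) (sym deg≡d) d∈xs))
  ... | no deg≰1 | outer s+n≤v = ⊥-elim (deg≰1 (deg-outer s+n≤v))

  labels-sorted : AllPairs (λ x y → deg G⁺ x ≤ deg G⁺ y) (L′ ++ X)
  labels-sorted = AllPairsP.++⁺ L′-sorted (Linked⇒AllPairs ≤-trans X-sorted)
    (All.tabulate λ v∈L′ → All.tabulate λ x∈X →
      old-below-inner (proj₁ (label-old v∈L′)) (label-internal v∈L′) (X-inner x∈X))
    where
    L′-sorted : AllPairs (λ x y → deg G⁺ x ≤ deg G⁺ y) L′
    L′-sorted = AllPairsP.map⁻ (subst (AllPairs _≤_) (map-cong-local (All.tabulate (sym ∘ label-deg)))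
                                      (AllPairsP.map⁺ {R = _≤_} {f = deg G′} IH.labels-sorted))

  labels-internal : All (λ v → 2 ≤ deg G⁺ v) (L′ ++ X)
  labels-internal = AllP.++⁺ (All.tabulate label-internal) (All.tabulate (inner-internal ∘ X-inner))

  leaf-neighbours-labelled : ∀ v → AdjLeaf G⁺ v → v ∈ L′ ++ X
  leaf-neighbours-labelled v (w , w-leaf , v~w) with position v
  ... | inner v-inner = ∈-++⁺ʳ L′ (inner-label v-inner)
  ... | outer s+n≤v = ⊥-elim ([ leaf≢u w-leaf , leaf-not-inner ]′ (outer-neighbour s+n≤v v~w))
    where leaf-not-inner : ¬ Inner w
          leaf-not-inner = ≤1⇒≱2 (≤-reflexive w-leaf) ∘ inner-internal
  ... | old v<s with v ≟ u
  ...   | no v≢u = ∈-++⁺ˡ (IH.leaf-neighbours-labelled v (w , w-leaf′ , v~w′))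
    where
    v~w′ : Adj G′ v w
    v~w′ = old-neighbour v<s v≢u v~w
    w<s : w < s
    w<s = proj₂ (Adj-G-in-range v~w′)
    w-leaf′ : deg G′ w ≡ 1
    w-leaf′ = trans (sym (deg-old w<s (leaf≢u w-leaf))) w-leaf
  ...   | yes refl with root-neighbour v~w
  ...     | inj₂ (s≤w , w<s+n) = ⊥-elim (≤1⇒≱2 (≤-reflexive w-leaf) (inner-internal (s≤w , w<s+n)))
  ...     | inj₁ u~w with leaf-neighbour-unique {G′} u-leaf (Adj-sym {G′} vₛ~u) u~w
  ...       | refl = ⊥-elim (≤1⇒≱2 (≤-reflexive w-leaf) (label-internal vₛ∈L′))

  vₛ≤post : All (λ y → deg G′ vₛ ≤ deg G′ y) post
  vₛ≤post with AllPairs-++⁻ pre (subst (AllPairs _) L′≡ IH.labels-sorted)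
  ... | _ , vₛ≤ ∷ _ , _ = vₛ≤

  module _ (I : DegreeInversion G⁺) where
    open DegreeInversion I
    open DegreeInversionProperties I

    no-inversion-q≡u : p < s → p ≢ u → q ≡ u → ⊥
    no-inversion-q≡u p<s p≢u refl with root-neighbour q~b
    ... | inj₁ u~b = p≢u (avoiding-from-leaf {G′} u-leaf u~b (restrict-old q⇝p u<s p<s))
    ... | inj₂ (s≤b , b<s+n) = <⇒≱ deg-b<deg-a (old-below-inner a<s 2≤deg-a (s≤b , b<s+n))
      where a<s : a < s
            a<s = proj₂ (Adj-G-in-range (old-neighbour p<s p≢u p~a))

    -- Here p = vₛ and b is a leaf of G′, so q is labelled; by the choice of s it comes after vₛ.
    no-inversion-a≡u : p < s → p ≢ u → q < s → q ≢ u → a ≡ u → ⊥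
    no-inversion-a≡u p<s p≢u q<s q≢u refl = q-labelled (∈-++⁻ pre (subst (q ∈_) L′≡ q∈L′))
      where
      p≡vₛ : p ≡ vₛ
      p≡vₛ = leaf-neighbour-unique {G′} u-leaf (Adj-sym {G′} (old-neighbour p<s p≢u p~a))
                                              (Adj-sym {G′} vₛ~u)
      q~b′ : Adj G′ q b
      q~b′ = old-neighbour q<s q≢u q~b
      b<s : b < s
      b<s = proj₂ (Adj-G-in-range q~b′)
      deg-b≤1 : deg G⁺ b ≤ 1
      deg-b≤1 with deg G⁺ b ≤? 1
      ... | yes deg≤1 = deg≤1
      ... | no deg≰1 = ⊥-elim (<⇒≱ deg-b<deg-a (root-below-old b<s (≰⇒> deg≰1)))
      b-leaf : deg G′ b ≡ 1
      b-leaf = trans (sym (deg-old b<s b≢a)) (≤-antisym deg-b≤1 (Adj⇒1≤deg {G⁺} (Adj-sym {G⁺} q~b)))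
      q∈L′ : q ∈ L′
      q∈L′ = IH.leaf-neighbours-labelled q (b , b-leaf , q~b′)
      q-labelled : q ∈ pre ⊎ q ∈ vₛ ∷ post → ⊥
      q-labelled (inj₁ q∈pre) = All.lookup pre-no-leaf q∈pre (b , b-leaf , q~b′)
      q-labelled (inj₂ (here q≡vₛ)) = p≢q (trans p≡vₛ (sym q≡vₛ))
      q-labelled (inj₂ (there q∈post)) = <⇒≱ deg-q<deg-p
        (subst₂ _≤_ (trans (cong (deg G′) (sym p≡vₛ)) (sym (deg-old p<s p≢u))) (sym (deg-old q<s q≢u))
                (All.lookup vₛ≤post q∈post))

    no-inversion-p-old : p < s → p ≢ u → q < s → ⊥
    no-inversion-p-old p<s p≢u q<s with q ≟ u | a ≟ u
    ... | yes q≡u | _ = no-inversion-q≡u p<s p≢u q≡u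
    ... | no q≢u | yes a≡u = no-inversion-a≡u p<s p≢u q<s q≢u a≡u
    ... | no q≢u | no a≢u = IH.no-inversion (restrict-inversion I p<s p≢u q<s q≢u a≢u)

    inversion-absurd : ⊥
    inversion-absurd with inversion-position I
    ... | p<s , inj₂ q-inner = <⇒≱ deg-q<deg-p (old-below-inner p<s (≤-trans (n≤1+n 2) 3≤deg-p) q-inner)
    ... | p<s , inj₁ q<s with p ≟ u
    ...   | yes refl = <⇒≱ deg-q<deg-p (root-below-old q<s 2≤deg-q)
    ...   | no p≢u = no-inversion-p-old p<s p≢u q<s

  no-inversion : ¬ DegreeInversion G⁺
  no-inversion = inversion-absurd

  invariant : GreedyInvariant (xs ++ D′ ++ dt ∷ []) G⁺ (L′ ++ X)
  invariant = record
    { in-range = G⁺-in-range ; degree-in-D = degree-in-D ; labels-sorted = labels-sorted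
    ; labels-internal = labels-internal ; leaf-neighbours-labelled = leaf-neighbours-labelled
    ; no-inversion = no-inversion }

greedy-invariant : ∀ {D G L} → IsM D G L → Nonincreasing D → All (2 ≤_) D → GreedyInvariant D G L
greedy-invariant (base ds dt X t≤1+dt X-labels X-sorted) D-sorted D≥2 =
  Base.invariant ds dt X t≤1+dt X-labels X-sorted D-sorted D≥2
greedy-invariant (rec xs D′ dt G′ L′ pre vₛ post u X k≡dt-1 _ M′ L′≡ pre-no-leaf u-leaf vₛ~u X-labels X-sorted)
                 D-sorted D≥2 =
  Step.invariant xs D′ dt G′ L′ pre vₛ post u X k≡dt-1 (greedy-invariant M′ D′-sorted D′≥2)
                 L′≡ pre-no-leaf u-leaf vₛ~u X-labels X-sorted D-sorted D≥2
  where
  D′-sorted : Nonincreasing D′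
  D′-sorted = proj₁ (AllPairs-++⁻ D′ (proj₁ (proj₂ (AllPairs-++⁻ xs D-sorted))))
  D′≥2 : All (2 ≤_) D′
  D′≥2 = AllP.++⁻ˡ D′ (AllP.++⁻ʳ xs D≥2)

-- Levels of a rooted tree

walk-avoids-distant : ∀ {G r x k z} → Walk G r x k → (∀ j → j < suc k → ¬ Walk G r z j) →
  r ≢ z × AvoidingWalk G z r x
walk-avoids-distant {G} {r} {z = z} walk z-far = r≢z , avoiding walk z-far
  where
  r≢z : r ≢ z
  r≢z refl = z-far 0 (s≤s z≤n) here
  avoiding : ∀ {r x k} → Walk G r x k → (∀ j → j < suc k → ¬ Walk G r z j) → AvoidingWalk G z r x
  avoiding here _ = done
  avoiding (step {v = y} {k = k} ry rest) z-far = move ry y≢z (avoiding rest z-farther)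
    where
    y≢z : y ≢ z
    y≢z refl = z-far 1 (s≤s (s≤s z≤n)) (step ry here)
    z-farther : ∀ j → j < suc k → ¬ Walk G y z j
    z-farther j j<k y⇝z = z-far (suc j) (s≤s j<k) (step ry y⇝z)

root-walk : ∀ {G rs r₁ r₂ z} → Root G rs → r₁ ∈ rs → r₂ ∈ rs → r₂ ≢ z → AvoidingWalk G z r₁ r₂
root-walk (vroot r _) (here refl) (here refl) _ = done
root-walk (eroot r₁ r₂ _) (here refl) (here refl) _ = done
root-walk (eroot r₁ r₂ r₁~r₂) (here refl) (there (here refl)) r₂≢z = move r₁~r₂ r₂≢z done
root-walk {G} (eroot r₁ r₂ r₁~r₂) (there (here refl)) (here refl) r₁≢z = move (Adj-sym {G} r₁~r₂) r₁≢z done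
root-walk (eroot r₁ r₂ _) (there (here refl)) (there (here refl)) _ = done

same-level-walk : ∀ {G rs x y z k} → Root G rs →
  AtDist G rs x k → AtDist G rs y k → AtDist G rs z (suc k) → AvoidingWalk G z x y
same-level-walk {G} root (x-near , _) (y-near , _) (_ , z-far)
  with find x-near | find y-near
... | r₁ , r₁∈rs , r₁⇝x | r₂ , r₂∈rs , r₂⇝y
  with walk-avoids-distant r₁⇝x (All.lookup z-far r₁∈rs)
     | walk-avoids-distant r₂⇝y (All.lookup z-far r₂∈rs)
... | r₁≢z , r₁⇝x′ | r₂≢z , r₂⇝y′ =
  avoiding-++ (avoiding-reverse {G} r₁≢z r₁⇝x′) (avoiding-++ (root-walk root r₁∈rs r₂∈rs r₂≢z) r₂⇝y′)

lemma3p9 : ∀ (D : List ℕ) → ReducedDegSeq D →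
    ∀ (G : Graph) (L : List ℕ) → IsM D G L →
    ∀ (rs : List ℕ) → Root G rs →
    ∀ (k p q a b : ℕ) →
    AtDist G rs p k → AtDist G rs q k → deg G q < deg G p →
    Adj G p a → AtDist G rs a (suc k) →
    Adj G q b → AtDist G rs b (suc k) →
    deg G a ≤ deg G b
lemma3p9 D (_ , D-nonincreasing , D≥2 , _) G L M rs root k p q a b
         p-level q-level deg-q<deg-p p~a a-level q~b b-level with deg G a ≤? deg G b
... | yes deg-a≤deg-b = deg-a≤deg-b
... | no deg-a≰deg-b = ⊥-elim (GreedyInvariant.no-inversion invariant inversion)
  where
  invariant = greedy-invariant M (Linked⇒AllPairs (flip ≤-trans) D-nonincreasing) D≥2
  inversion : DegreeInversion G
  inversion = record
    { p~a = p~a ; q~b = q~b ; deg-q<deg-p = deg-q<deg-p ; deg-b<deg-a = ≰⇒> deg-a≰deg-b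
    ; p⇝q = same-level-walk root p-level q-level a-level
    ; q⇝p = same-level-walk root q-level p-level b-level }
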